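{- Let $G$ be a graph and let $k,N$ be positive integers. Let $[A,B]$ be an edge-cut of $G$ of order at most $k-1$. If both $G[A]$ and $G[B]$ are $k$-colorable with clustering $N$, then $G$ is $k$-colorable with clustering $N$.
   Context: Graphs are finite and may have loops and parallel edges. An edge-cut $[A,B]$ of $G$ is a pair of disjoint subsets of $V(G)$ with $A\cup B=V(G)$; its order is the number of edges of $G$ with one end in $A$ and one end in $B$. $G[S]$ is the subgraph induced by $S$. For positive integers $k,N$, $G$ is $k$-colorable with clustering $N$ if there is $c:V(G)\to\{1,\dots,k\}$ such that every connected component of each induced subgraph $G[c^{ -1}(i)]$ has at most $N$ vertices. -}

module Defs where

open import Data.Nat using (ℕ; _≤_; _<_)
open import Data.Fin using (Fin)
open import Data.Product using (_×_; _,_; Σ; ∃; proj₁; proj₂)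
open import Data.Sum using (_⊎_)
open import Data.List using (List; []; _∷_; length)
open import Data.List.Relation.Unary.All using (All)
open import Data.List.Relation.Unary.Unique.Propositional using (Unique)
open import Relation.Binary.PropositionalEquality using (_≡_)
open import Relation.Nullary using (¬_)

-- A finite multigraph (loops and parallel edges allowed):
-- vertices Fin n, edges Fin m, each edge has an (unordered) pair of ends.
record Graph : Set where
  field
    n    : ℕ
    m    : ℕ
    ends : Fin m → Fin n × Fin n

open Graph public

Vertex : Graph → Set
Vertex G = Fin (n G)

EdgeId : Graph → Set
EdgeId G = Fin (m G)

VSet : Graph → Set₁
VSet G = Vertex G → Set

Adj : (G : Graph) → Vertex G → Vertex G → Set
Adj G u v = Σ (EdgeId G) λ e → (ends G e ≡ (u , v)) ⊎ (ends G e ≡ (v , u))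

data ConnIn (G : Graph) (S : VSet G) : Vertex G → Vertex G → Set where
  here : ∀ {v} → S v → ConnIn G S v v
  step : ∀ {u w v} → S u → Adj G u w → ConnIn G S w v → ConnIn G S u v

-- Every connected component of G[S] has at most N vertices:
-- any list of distinct vertices all in the component of v has length ≤ N.
ComponentsBounded : (G : Graph) → VSet G → ℕ → Set
ComponentsBounded G S N =
  ∀ (v : Vertex G) (us : List (Vertex G)) →
    Unique us → All (λ u → ConnIn G S v u) us → length us ≤ N

-- G[S] is k-colorable with clustering N.  A coloring of G[S] is given by a
-- map c on V(G) of which only the values on S matter; colour class i of G[S]
-- is S ∩ c⁻¹(i).
InducedColorableWithClustering : (G : Graph) → VSet G → ℕ → ℕ → Set
InducedColorableWithClustering G S k N =
  Σ (Vertex G → Fin k) λ c →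
    ∀ (i : Fin k) → ComponentsBounded G (λ v → S v × c v ≡ i) N

ColorableWithClustering : Graph → ℕ → ℕ → Set
ColorableWithClustering G k N =
  Σ (Vertex G → Fin k) λ c →
    ∀ (i : Fin k) → ComponentsBounded G (λ v → c v ≡ i) N

IsEdgeCut : (G : Graph) → VSet G → VSet G → Set
IsEdgeCut G A B = (∀ v → ¬ (A v × B v)) × (∀ v → A v ⊎ B v)

Crosses : (G : Graph) → VSet G → VSet G → EdgeId G → Set
Crosses G A B e =
  (A (proj₁ (ends G e)) × B (proj₂ (ends G e))) ⊎
  (B (proj₁ (ends G e)) × A (proj₂ (ends G e)))

OrderAtMost : (G : Graph) → VSet G → VSet G → ℕ → Set
OrderAtMost G A B r =
  ∀ (es : List (EdgeId G)) → Unique es → All (Crosses G A B) es → length es ≤ r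

module Submission where

-- Colour A by cA and B by
-- σ ∘ cB, where σ is a permutation of the colours.  The k cyclic shifts
-- x ↦ s + x (mod k) form a Latin square: a crossing edge ab becomes
-- monochromatic for exactly the shift s with s + cB b = cA a.  Since there are
-- fewer than k crossing edges, pigeonhole gives a shift making no crossing
-- edge monochromatic.  For that shift every monochromatic walk stays on one
-- side of the cut, so each colour class component of G is a colour class
-- component of G[A] or of G[B], and clustering N is inherited.

open import Defs
open import Data.Nat using (ℕ; suc; _+_; _≤_; _<_; _∸_; _%_; z≤n; NonZero)
open import Data.Nat.Properties using (+-comm; +-assoc; m+[n∸m]≡n; <⇒≤; ≤-<-trans; n<1+n)
open import Data.Nat.DivMod using (_mod_; %-distribˡ-+; [m+n]%n≡m%n; m<n⇒m%n≡m)
open import Data.Fin using (Fin; toℕ)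
open import Data.Fin.Properties using (toℕ-injective; toℕ-fromℕ<; toℕ<n; pigeonhole; ¬∀⟶∃¬; <⇒≢)
  renaming (_≟_ to _≟ᶠ_)
open import Data.Product using (_×_; _,_; Σ; ∃; proj₁; proj₂)
open import Data.Sum using (_⊎_; inj₁; inj₂; [_,_]′)
open import Data.Empty using (⊥; ⊥-elim)
open import Data.List using (List; []; _∷_; length; filter; allFin; lookup)
open import Data.List.Relation.Unary.All as All using (All; _∷_)
open import Data.List.Relation.Unary.All.Properties using (all-filter)
open import Data.List.Relation.Unary.Any as Any using (Any; index)
open import Data.List.Relation.Unary.Any.Properties using (lookup-index)
open import Data.List.Membership.Propositional using (lose)
open import Data.List.Membership.Propositional.Properties using (∈-filter⁺; ∈-allFin)
open import Data.List.Relation.Unary.Unique.Propositional.Properties as Unique using ()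
open import Function using (Injective)
open import Relation.Binary.PropositionalEquality
  using (_≡_; _≢_; refl; sym; trans; cong; subst; module ≡-Reasoning)
open import Relation.Nullary using (¬_; Dec; yes; no; _×-dec_; _⊎-dec_)

-- Adding x modulo d is injective on residues: subtracting x again, i.e.
-- adding d ∸ x, recovers the summand.
+-%-cancelˡ : ∀ {d} .{{_ : NonZero d}} x {s t} → x ≤ d → s < d → t < d →
              (x + s) % d ≡ (x + t) % d → s ≡ t
+-%-cancelˡ {d} x {s} {t} x≤d s<d t<d eq = begin
  s                                     ≡⟨ undo s s<d ⟨
  ((x + s) % d + (d ∸ x) % d) % d       ≡⟨ cong (λ r → (r + (d ∸ x) % d) % d) eq ⟩
  ((x + t) % d + (d ∸ x) % d) % d       ≡⟨ undo t t<d ⟩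
  t                                     ∎
  where
  open ≡-Reasoning
  undo : ∀ y → y < d → ((x + y) % d + (d ∸ x) % d) % d ≡ y
  undo y y<d = begin
    ((x + y) % d + (d ∸ x) % d) % d     ≡⟨ %-distribˡ-+ (x + y) (d ∸ x) d ⟨
    (x + y + (d ∸ x)) % d               ≡⟨ cong (λ r → (r + (d ∸ x)) % d) (+-comm x y) ⟩
    (y + x + (d ∸ x)) % d               ≡⟨ cong (_% d) (+-assoc y x (d ∸ x)) ⟩
    (y + (x + (d ∸ x))) % d             ≡⟨ cong (λ r → (y + r) % d) (m+[n∸m]≡n x≤d) ⟩
    (y + d) % d                         ≡⟨ [m+n]%n≡m%n y d ⟩
    y % d                               ≡⟨ m<n⇒m%n≡m y<d ⟩
    y                                   ∎

shift : ∀ {d} .{{_ : NonZero d}} → Fin d → Fin d → Fin d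
shift {d} s x = (toℕ s + toℕ x) mod d

toℕ-shift : ∀ {d} .{{_ : NonZero d}} (s x : Fin d) → toℕ (shift s x) ≡ (toℕ s + toℕ x) % d
toℕ-shift s x = toℕ-fromℕ< _

shift-injectiveʳ : ∀ {d} .{{_ : NonZero d}} (s : Fin d) → Injective _≡_ _≡_ (shift s)
shift-injectiveʳ s {x} {y} eq = toℕ-injective
  (+-%-cancelˡ (toℕ s) (<⇒≤ (toℕ<n s)) (toℕ<n x) (toℕ<n y)
    (trans (sym (toℕ-shift s x)) (trans (cong toℕ eq) (toℕ-shift s y))))

shift-injectiveˡ : ∀ {d} .{{_ : NonZero d}} {s t : Fin d} x → shift s x ≡ shift t x → s ≡ t
shift-injectiveˡ {d} {s} {t} x eq = toℕ-injective
  (+-%-cancelˡ (toℕ x) (<⇒≤ (toℕ<n x)) (toℕ<n s) (toℕ<n t) (begin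
    (toℕ x + toℕ s) % d   ≡⟨ cong (_% d) (+-comm (toℕ x) (toℕ s)) ⟩
    (toℕ s + toℕ x) % d   ≡⟨ toℕ-shift s x ⟨
    toℕ (shift s x)       ≡⟨ cong toℕ eq ⟩
    toℕ (shift t x)       ≡⟨ toℕ-shift t x ⟩
    (toℕ t + toℕ x) % d   ≡⟨ cong (_% d) (+-comm (toℕ t) (toℕ x)) ⟩
    (toℕ x + toℕ t) % d   ∎))
  where open ≡-Reasoning

-- If every element of a list forbids at most one index, and the list is
-- shorter than the number of indices, some index is forbidden by no element:
-- otherwise "the position of a forbidding element" would inject Fin d into a
-- smaller Fin.
unforbidden-index : ∀ {d} {X : Set} (Forbids : X → Fin d → Set) →
  (∀ x s → Dec (Forbids x s)) →
  (∀ {x s t} → Forbids x s → Forbids x t → s ≡ t) →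
  (xs : List X) → length xs < d → ∃ λ s → ¬ Any (λ x → Forbids x s) xs
unforbidden-index {d} Forbids forbids? at-most-one xs short =
  ¬∀⟶∃¬ d _ (λ s → Any.any? (λ x → forbids? x s) xs) not-all-forbidden
  where
  not-all-forbidden : ¬ (∀ s → Any (λ x → Forbids x s) xs)
  not-all-forbidden hit with i , j , i<j , same ← pigeonhole short (λ s → index (hit s)) =
    <⇒≢ i<j (at-most-one (lookup-index (hit i))
                         (subst (λ p → Forbids (lookup xs p) j) (sym same) (lookup-index (hit j))))

module _ {G : Graph} where

  adj-sym : ∀ {u w} → Adj G u w → Adj G w u
  adj-sym (e , inj₁ eq) = e , inj₂ eq
  adj-sym (e , inj₂ eq) = e , inj₁ eq

  walk-source : ∀ {S : VSet G} {u x} → ConnIn G S u x → S u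
  walk-source (here su)     = su
  walk-source (step su _ _) = su

  walk-mono : ∀ {S T : VSet G} → (∀ {v} → S v → T v) → ∀ {u x} → ConnIn G S u x → ConnIn G T u x
  walk-mono S⊆T (here su)         = here (S⊆T su)
  walk-mono S⊆T (step su adj wlk) = step (S⊆T su) adj (walk-mono S⊆T wlk)

  walk-confined : ∀ {S P : VSet G} →
    (∀ {u w} → S u → S w → Adj G u w → P u → P w) →
    ∀ {u x} → ConnIn G S u x → P u → ConnIn G (λ v → S v × P v) u x
  walk-confined closed (here su)         pu = here (su , pu)
  walk-confined closed (step su adj wlk) pu =
    step (su , pu) adj (walk-confined closed wlk (closed su (walk-source wlk) adj pu))

  components-bounded-via : ∀ {S : VSet G} {N} →
    (∀ v → S v → Σ (VSet G) λ T → ComponentsBounded G T N × (∀ {x} → ConnIn G S v x → ConnIn G T v x)) →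
    ComponentsBounded G S N
  components-bounded-via cover v []        _        _                 = z≤n
  components-bounded-via cover v us@(_ ∷ _) distinct walks@(first ∷ _)
    with T , bounded , transfer ← cover v (walk-source first) =
    bounded v us distinct (All.map transfer walks)

module EdgeCut (G : Graph) {A B : VSet G}
  (disjoint : ∀ v → ¬ (A v × B v)) (covering : ∀ v → A v ⊎ B v) where

  end₁ end₂ : EdgeId G → Vertex G
  end₁ e = proj₁ (ends G e)
  end₂ e = proj₂ (ends G e)

  -- Because [A,B] partitions V(G), membership in A and in B is decidable.
  A? : ∀ v → Dec (A v)
  A? v = [ yes , (λ b → no (λ a → disjoint v (a , b))) ]′ (covering v)

  B? : ∀ v → Dec (B v)
  B? v = [ (λ a → no (λ b → disjoint v (a , b))) , yes ]′ (covering v)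

  Crosses? : ∀ e → Dec (Crosses G A B e)
  Crosses? e = (A? (end₁ e) ×-dec B? (end₂ e)) ⊎-dec (B? (end₁ e) ×-dec A? (end₂ e))

  crossingEdges : List (EdgeId G)
  crossingEdges = filter Crosses? (allFin (m G))

  few-crossingEdges : ∀ {r} → OrderAtMost G A B r → length crossingEdges ≤ r
  few-crossingEdges order = order crossingEdges
    (Unique.filter⁺ Crosses? (Unique.allFin⁺ (m G))) (all-filter Crosses? (allFin (m G)))

  Separating : ∀ {k} → (Vertex G → Fin k) → Set
  Separating c = ∀ e → Crosses G A B e → c (end₁ e) ≢ c (end₂ e)

  at-ends : ∀ {e u w} (P : Vertex G → Vertex G → Set) → ends G e ≡ (u , w) → P u w → P (end₁ e) (end₂ e)
  at-ends P eq puw rewrite eq = puw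

  separated : ∀ {k} {c : Vertex G → Fin k} → Separating c →
    ∀ {u w} → Adj G u w → c u ≡ c w → A u → B w → ⊥
  separated {c = c} sep (e , inj₁ eq) same a b =
    sep e (at-ends (λ x y → (A x × B y) ⊎ (B x × A y)) eq (inj₁ (a , b)))
          (at-ends (λ x y → c x ≡ c y) eq same)
  separated {c = c} sep (e , inj₂ eq) same a b =
    sep e (at-ends (λ x y → (A x × B y) ⊎ (B x × A y)) eq (inj₂ (b , a)))
          (at-ends (λ x y → c x ≡ c y) eq (sym same))

  stays-in-A : ∀ {k} {c : Vertex G → Fin k} → Separating c →
    ∀ {u w} → Adj G u w → c u ≡ c w → A u → A w
  stays-in-A sep {w = w} adj same a =
    [ (λ a′ → a′) , (λ b → ⊥-elim (separated sep adj same a b)) ]′ (covering w)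

  stays-in-B : ∀ {k} {c : Vertex G → Fin k} → Separating c →
    ∀ {u w} → Adj G u w → c u ≡ c w → B u → B w
  stays-in-B sep {w = w} adj same b =
    [ (λ a → ⊥-elim (separated sep (adj-sym adj) (sym same) a b)) , (λ b′ → b′) ]′ (covering w)

  module Glue {k} (cA cB : Vertex G → Fin k) (σ : Fin k → Fin k) where

    glue : Vertex G → Fin k
    glue v = [ (λ _ → cA v) , (λ _ → σ (cB v)) ]′ (covering v)

    glue-A : ∀ {v} → A v → glue v ≡ cA v
    glue-A {v} a with covering v
    ... | inj₁ _ = refl
    ... | inj₂ b = ⊥-elim (disjoint v (a , b))

    glue-B : ∀ {v} → B v → glue v ≡ σ (cB v)
    glue-B {v} b with covering v
    ... | inj₁ a = ⊥-elim (disjoint v (a , b))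
    ... | inj₂ _ = refl

    -- If σ is a permutation and the glued colouring is separating, each of
    -- its colour classes splits into colour classes of G[A] and of G[B], so
    -- it inherits their clustering.
    glue-clustered : Injective _≡_ _≡_ σ → Separating glue → ∀ {N} →
      (∀ i → ComponentsBounded G (λ v → A v × cA v ≡ i) N) →
      (∀ i → ComponentsBounded G (λ v → B v × cB v ≡ i) N) →
      ∀ i → ComponentsBounded G (λ v → glue v ≡ i) N
    glue-clustered σ-injective sep {N} clusteredA clusteredB i =
      components-bounded-via λ v glue-v → [ within-A v , within-B v glue-v ]′ (covering v)
      where
      Class : VSet G
      Class v = glue v ≡ i

      within-A : ∀ v → A v → Σ (VSet G) λ T →
        ComponentsBounded G T N × (∀ {x} → ConnIn G Class v x → ConnIn G T v x)
      within-A v a = (λ u → A u × cA u ≡ i) , clusteredA i ,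
        λ walk → walk-mono recolour (walk-confined (λ su sw adj → stays-in-A sep adj (trans su (sym sw))) walk a)
        where
        recolour : ∀ {u} → Class u × A u → A u × cA u ≡ i
        recolour (glue-u , a′) = a′ , trans (sym (glue-A a′)) glue-u

      within-B : ∀ v → Class v → B v → Σ (VSet G) λ T →
        ComponentsBounded G T N × (∀ {x} → ConnIn G Class v x → ConnIn G T v x)
      within-B v glue-v b = (λ u → B u × cB u ≡ cB v) , clusteredB (cB v) ,
        λ walk → walk-mono recolour (walk-confined (λ su sw adj → stays-in-B sep adj (trans su (sym sw))) walk b)
        where
        recolour : ∀ {u} → Class u × B u → B u × cB u ≡ cB v
        recolour {u} (glue-u , b′) = b′ , σ-injective (begin
          σ (cB u)   ≡⟨ glue-B b′ ⟨
          glue u     ≡⟨ glue-u ⟩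
          i          ≡⟨ glue-v ⟨
          glue v     ≡⟨ glue-B b ⟩
          σ (cB v)   ∎)
          where open ≡-Reasoning

  module _ {d} .{{_ : NonZero d}} (cA cB : Vertex G → Fin d) where
    open Glue cA cB

    ShiftForbidden : EdgeId G → Fin d → Set
    ShiftForbidden e s = Crosses G A B e × glue (shift s) (end₁ e) ≡ glue (shift s) (end₂ e)

    shift-forbidden? : ∀ e s → Dec (ShiftForbidden e s)
    shift-forbidden? e s = Crosses? e ×-dec (glue (shift s) (end₁ e) ≟ᶠ glue (shift s) (end₂ e))

    forced-shift : ∀ s {u w} → A u → B w → glue (shift s) u ≡ glue (shift s) w → shift s (cB w) ≡ cA u
    forced-shift s a b mono = trans (sym (glue-B (shift s) b)) (trans (sym mono) (glue-A (shift s) a))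

    -- Hence (Latin square property) each edge forbids at most one shift.
    forbids-at-most-one : ∀ {e s t} → ShiftForbidden e s → ShiftForbidden e t → s ≡ t
    forbids-at-most-one {s = s} {t} (inj₁ (a , b) , mono-s) (_ , mono-t) =
      shift-injectiveˡ _ (trans (forced-shift s a b mono-s) (sym (forced-shift t a b mono-t)))
    forbids-at-most-one {s = s} {t} (inj₂ (b , a) , mono-s) (_ , mono-t) =
      shift-injectiveˡ _ (trans (forced-shift s a b (sym mono-s)) (sym (forced-shift t a b (sym mono-t))))

    separating-shift : ∀ {r} → OrderAtMost G A B r → r < d → ∃ λ s → Separating (glue (shift s))
    separating-shift order r<d
      with s , unforbidden ← unforbidden-index ShiftForbidden shift-forbidden? forbids-at-most-one
                               crossingEdges (≤-<-trans (few-crossingEdges order) r<d) =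
      s , λ e crosses mono → unforbidden (lose (∈-filter⁺ Crosses? (∈-allFin e) crosses) (crosses , mono))

lemma4p4 : (G : Graph) (k N : ℕ) (A B : VSet G) →
    1 ≤ k → 1 ≤ N →
    IsEdgeCut G A B →
    OrderAtMost G A B (k ∸ 1) →
    InducedColorableWithClustering G A k N →
    InducedColorableWithClustering G B k N →
    ColorableWithClustering G k N
lemma4p4 G (suc k′) N A B _ _ (disjoint , covering) order (cA , clusteredA) (cB , clusteredB) =
  glue (shift s) , glue-clustered (shift s) (shift-injectiveʳ s) separating clusteredA clusteredB
  where
  open EdgeCut G disjoint covering
  open Glue cA cB
  chosen : ∃ λ (s : Fin (suc k′)) → Separating (glue (shift s))
  chosen = separating-shift cA cB order (n<1+n k′)
  s : Fin (suc k′)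
  s = proj₁ chosen
  separating : Separating (glue (shift s))
  separating = proj₂ chosen
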